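{- Let $n,h\ge2$, let $\mu$ be an integer with $h/2<\mu\le h$, and let $l$ be an integer with $2\le l\le n$. Then there exists $p\in\mathcal{P}$ such that $\Gamma_\mu(p)$ is $l$-cyclic if and only if $\mu\le\frac{l-1}{l}h$.
   Context: $N=\{1,\dots,n\}$, $H=\{1,\dots,h\}$, $\mathcal{P}=\mathcal{L}(N)^h$ the set of profiles of linear orders on $N$; $x>_{p_i}y$ means individual $i$ ranks $x$ above $y$. For $p\in\mathcal{P}$, $\Gamma_\mu(p)$ is the directed graph with vertex set $N$ and arc set $\{(x,y)\in N^2: |\{i\in H:x>_{p_i}y\}|\ge\mu\}$. A directed graph $(V,A)$ is an $l$-cycle if $|V|=l$ and its vertices can be ordered $x_1,\dots,x_l$ with $A=\{(x_j,x_{j+1}):1\le j\le l\}$, $x_{l+1}=x_1$. A graph is $l$-cyclic if it has a subgraph (vertex and arc subsets) that is an $l$-cycle. -}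

module Defs where

open import Data.Nat using (ℕ; zero; suc; _≤_; _<_; _%_)
open import Data.Nat.DivMod using (m%n<n)
open import Data.Fin using (Fin; toℕ; fromℕ<)
open import Data.Fin.Permutation using (Permutation′; _⟨$⟩ʳ_)
open import Data.List using (length; filter)
open import Data.List.Base using (allFin)
open import Data.Nat.Properties using (_<?_)
open import Data.Product using (∃; _×_)
open import Data.Empty using (⊥)
open import Function.Definitions using (Injective)
open import Relation.Binary.PropositionalEquality using (_≡_)

-- A linear order on N = Fin n, encoded as a ranking bijection:
-- σ ⟨$⟩ʳ x is the position of x (position 0 = top).
LinOrder : ℕ → Set
LinOrder n = Permutation′ n

_≻[_]_ : ∀ {n} → Fin n → LinOrder n → Fin n → Set
x ≻[ σ ] y = toℕ (σ ⟨$⟩ʳ x) < toℕ (σ ⟨$⟩ʳ y)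

Profile : ℕ → ℕ → Set
Profile n h = Fin h → LinOrder n

support : ∀ {n h} → Profile n h → Fin n → Fin n → ℕ
support {n} {h} p x y =
  length (filter (λ i → toℕ (p i ⟨$⟩ʳ x) <? toℕ (p i ⟨$⟩ʳ y)) (allFin h))

Arc : ∀ {n h} → ℕ → Profile n h → Fin n → Fin n → Set
Arc μ p x y = μ ≤ support p x y

next : ∀ {m} → Fin (suc m) → Fin (suc m)
next {m} j = fromℕ< (m%n<n (suc (toℕ j)) (suc m))

IsCyclic : ∀ {n} → ℕ → (Fin n → Fin n → Set) → Set
IsCyclic zero A = ⊥
IsCyclic {n} (suc m) A =
  ∃ λ (c : Fin (suc m) → Fin n) → Injective _≡_ _≡_ c × (∀ j → A (c j) (c (next j)))

-- Necessity is double counting: every voter ranks the successor of its lowest cycle vertex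
-- above it, so it supports at most l − 1 of the l arcs, whence l·μ ≤ Σ arc supports ≤ (l − 1)·h.
-- Sufficiency: l·μ ≤ (l − 1)·h says h ≤ l·(h − μ), so the voters split into l blocks of at most
-- h − μ voters each. Block k ranks the alternatives cyclically starting from x_k; then the arc
-- (x_j, x_{j+1}) is opposed only by the block k = j + 1 and has support at least μ.
module Submission where

open import Defs
open import Data.Fin using (Fin; zero; suc; toℕ; fromℕ<; inject≤; punchIn)
open import Data.Fin.Permutation using (_⟨$⟩ʳ_; permutation)
open import Data.Fin.Properties using (toℕ-fromℕ<; toℕ-injective; toℕ<n; toℕ-inject≤; inject≤-injective)
open import Data.List using (length; filter; tabulate; allFin)
open import Data.List.Extrema.Nat using (argmax; f[xs]≤f[argmax])
open import Data.List.Membership.Propositional.Properties using (∈-allFin)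
open import Data.List.Relation.Unary.All as All using ()
open import Data.Nat using (ℕ; zero; suc; _+_; _*_; _∸_; _/_; _%_; _≤_; _<_; z≤n; s≤s; s≤s⁻¹; NonZero; >-nonZero)
open import Data.Nat.DivMod using (m≡m%n+[m/n]*n; m%n<n; m/n*n≤m; m<n*o⇒m/o<n; m≤n⇒m%n≡m; n%n≡0)
open import Data.Nat.Properties
open import Data.Product using (∃; _×_; _,_; proj₁; proj₂)
open import Data.Sum using (_⊎_; inj₁; inj₂)
open import Function using (_∘_; id)
open import Function.Bundles using (_⇔_; mk⇔)
open import Relation.Binary.PropositionalEquality
open import Relation.Nullary using (Dec; yes; no; ¬_; contradiction)
open import Relation.Unary using (Pred; Decidable)

open import Algebra.Properties.CommutativeMonoid.Sum +-0-commutativeMonoid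
  using (sum-syntax; sum-cong-≗; sum-remove; ∑-comm)

indicator : ∀ {p} {P : Set p} → Dec P → ℕ
indicator (yes _) = 1
indicator (no _)  = 0

indicator≤1 : ∀ {p} {P : Set p} (P? : Dec P) → indicator P? ≤ 1
indicator≤1 (yes _) = s≤s z≤n
indicator≤1 (no _)  = z≤n

indicator-¬ : ∀ {p} {P : Set p} (P? : Dec P) → ¬ P → indicator P? ≡ 0
indicator-¬ (yes p) ¬p = contradiction p ¬p
indicator-¬ (no _)  _  = refl

count : ∀ {n p} {P : Pred (Fin n) p} → Decidable P → ℕ
count {n} P? = ∑[ i < n ] indicator (P? i)

∑≤n*c : ∀ {n c} (f : Fin n → ℕ) → (∀ i → f i ≤ c) → ∑[ i < n ] f i ≤ n * c
∑≤n*c {zero}  f f≤c = z≤n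
∑≤n*c {suc n} f f≤c = +-mono-≤ (f≤c zero) (∑≤n*c (f ∘ suc) (f≤c ∘ suc))

n*c≤∑ : ∀ {n c} (f : Fin n → ℕ) → (∀ i → c ≤ f i) → n * c ≤ ∑[ i < n ] f i
n*c≤∑ {zero}  f c≤f = z≤n
n*c≤∑ {suc n} f c≤f = +-mono-≤ (c≤f zero) (n*c≤∑ (f ∘ suc) (c≤f ∘ suc))

length-filter-tabulate : ∀ {a p n} {A : Set a} {P : Pred A p} (P? : Decidable P) (f : Fin n → A) →
  length (filter P? (tabulate f)) ≡ ∑[ i < n ] indicator (P? (f i))
length-filter-tabulate {n = zero}  P? f = refl
length-filter-tabulate {n = suc n} P? f with P? (f zero)
... | yes _ = cong suc (length-filter-tabulate P? (f ∘ suc))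
... | no _  = length-filter-tabulate P? (f ∘ suc)

count-cover : ∀ {n p q} {P : Pred (Fin n) p} {Q : Pred (Fin n) q} (P? : Decidable P) (Q? : Decidable Q) →
  (∀ i → ¬ P i → Q i) → n ≤ count P? + count Q?
count-cover {zero} P? Q? ¬P⇒Q = z≤n
count-cover {suc n} P? Q? ¬P⇒Q with P? zero | Q? zero | count-cover (P? ∘ suc) (Q? ∘ suc) (¬P⇒Q ∘ suc)
... | yes _  | Q?₀   | ih = s≤s (≤-trans ih (+-monoʳ-≤ (count (P? ∘ suc)) (m≤n+m (count (Q? ∘ suc)) (indicator Q?₀))))
... | no _   | yes _ | ih = ≤-trans (s≤s ih) (≤-reflexive (sym (+-suc (count (P? ∘ suc)) (count (Q? ∘ suc)))))
... | no ¬p₀ | no ¬q₀ | _ = contradiction (¬P⇒Q zero ¬p₀) ¬q₀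

count-interval : ∀ {n q} {Q : Pred (Fin n) q} (Q? : Decidable Q) a d →
  (∀ i → Q i → a ≤ toℕ i × toℕ i < a + d) → count Q? ≤ d
count-interval {zero}  Q? a d inside = z≤n
count-interval {suc n} Q? a d inside with Q? zero
count-interval {suc n} Q? (suc a) d       inside | yes q₀ = contradiction (proj₁ (inside zero q₀)) λ ()
count-interval {suc n} Q? zero    zero    inside | yes q₀ = contradiction (proj₂ (inside zero q₀)) λ ()
count-interval {suc n} Q? zero    (suc d) inside | yes _  =
  s≤s (count-interval (Q? ∘ suc) 0 d λ i q → z≤n , s≤s⁻¹ (proj₂ (inside (suc i) q)))
count-interval {suc n} Q? zero    d       inside | no _   =
  count-interval (Q? ∘ suc) 0 d λ i q → z≤n , <-trans (n<1+n (toℕ i)) (proj₂ (inside (suc i) q))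
count-interval {suc n} Q? (suc a) d       inside | no _   =
  count-interval (Q? ∘ suc) a d λ i q → let a≤i , i<a+d = inside (suc i) q in s≤s⁻¹ a≤i , s≤s⁻¹ i<a+d

support≡count : ∀ {n h} (p : Profile n h) x y →
  support p x y ≡ count (λ i → toℕ (p i ⟨$⟩ʳ x) <? toℕ (p i ⟨$⟩ʳ y))
support≡count p x y = length-filter-tabulate (λ i → toℕ (p i ⟨$⟩ʳ x) <? toℕ (p i ⟨$⟩ʳ y)) id

argmax-Fin : ∀ {m} (r : Fin (suc m) → ℕ) → ∃ λ top → ∀ j → r j ≤ r top
argmax-Fin r = argmax r zero (allFin _) , λ j → All.lookup (f[xs]≤f[argmax] {f = r} zero (allFin _)) (∈-allFin j)

cyclic-ascents≤ : ∀ {m} (r : Fin (suc m) → ℕ) → count (λ j → r j <? r (next j)) ≤ m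
cyclic-ascents≤ {m} r = begin
  count ascent?                                      ≡⟨ sum-remove {i = top} (indicator ∘ ascent?) ⟩
  indicator (ascent? top) + ∑[ j < m ] rest j         ≡⟨ cong (_+ ∑[ j < m ] rest j) no-ascent-at-top ⟩
  ∑[ j < m ] rest j                                   ≤⟨ ∑≤n*c rest (λ j → indicator≤1 (ascent? _)) ⟩
  m * 1                                               ≡⟨ *-identityʳ m ⟩
  m                                                   ∎
  where
  open ≤-Reasoning
  ascent? : Decidable (λ j → r j < r (next j))
  ascent? j = r j <? r (next j)
  top : Fin (suc m)
  top = proj₁ (argmax-Fin r)
  rest : Fin m → ℕ
  rest j = indicator (ascent? (punchIn top j))
  no-ascent-at-top : indicator (ascent? top) ≡ 0
  no-ascent-at-top = indicator-¬ (ascent? top) (≤⇒≯ (proj₂ (argmax-Fin r) (next top)))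

∑-support≤ : ∀ {n h m} (p : Profile n h) (c : Fin (suc m) → Fin n) →
  ∑[ j < suc m ] support p (c j) (c (next j)) ≤ m * h
∑-support≤ {n} {h} {m} p c = begin
  ∑[ j < suc m ] support p (c j) (c (next j))      ≡⟨ sum-cong-≗ (λ j → support≡count p (c j) (c (next j))) ⟩
  ∑[ j < suc m ] ∑[ i < h ] indicator (ascent? i j) ≡⟨ ∑-comm (λ j i → indicator (ascent? i j)) ⟩
  ∑[ i < h ] ∑[ j < suc m ] indicator (ascent? i j) ≤⟨ ∑≤n*c (λ i → ∑[ j < suc m ] indicator (ascent? i j))
                                                             (λ i → cyclic-ascents≤ (rank i)) ⟩
  h * m                                            ≡⟨ *-comm h m ⟩
  m * h                                            ∎
  where
  open ≤-Reasoning
  rank : Fin h → Fin (suc m) → ℕ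
  rank i j = toℕ (p i ⟨$⟩ʳ c j)
  ascent? : ∀ i j → Dec (rank i j < rank i (next j))
  ascent? i j = rank i j <? rank i (next j)

cyclic⇒l*μ≤[l∸1]*h : ∀ {n h m μ} (p : Profile n h) → IsCyclic (suc m) (Arc μ p) → suc m * μ ≤ m * h
cyclic⇒l*μ≤[l∸1]*h p (c , _ , arcs) = ≤-trans (n*c≤∑ (λ j → support p (c j) (c (next j))) arcs) (∑-support≤ p c)

rotate : ℕ → ℕ → ℕ → ℕ
rotate k k′ v with k ≤? v
... | yes _ = v ∸ k
... | no _  = v + k′

rotate-≥ : ∀ {k k′ v} → k ≤ v → rotate k k′ v ≡ v ∸ k
rotate-≥ {k} {k′} {v} k≤v with k ≤? v
... | yes _   = refl
... | no k≰v  = contradiction k≤v k≰v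

rotate-< : ∀ {k k′ v} → v < k → rotate k k′ v ≡ v + k′
rotate-< {k} {k′} {v} v<k with k ≤? v
... | yes k≤v = contradiction k≤v (<⇒≱ v<k)
... | no _    = refl

m≤n<m+o⇒n∸m<o : ∀ {m n o} → m ≤ n → n < m + o → n ∸ m < o
m≤n<m+o⇒n∸m<o {m} {n} {o} m≤n n<m+o = subst (n ∸ m <_) (m+n∸m≡n m o) (∸-monoˡ-< n<m+o m≤n)

rotate<k+k′ : ∀ {k k′ v} → v < k + k′ → rotate k k′ v < k + k′
rotate<k+k′ {k} {k′} {v} v<k+k′ with k ≤? v
... | yes _   = ≤-<-trans (m∸n≤m v k) v<k+k′
... | no k≰v  = +-monoˡ-< k′ (≰⇒> k≰v)

rotate-inverse : ∀ {k k′ v} → v < k + k′ → rotate k′ k (rotate k k′ v) ≡ v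
rotate-inverse {k} {k′} {v} v<k+k′ with k ≤? v
... | yes k≤v = trans (rotate-< (m≤n<m+o⇒n∸m<o k≤v v<k+k′)) (m∸n+n≡m k≤v)
... | no _    = trans (rotate-≥ (m≤n+m k′ v)) (m+n∸n≡m v k′)

rotate-suc : ∀ {k k′ v} → suc v ≢ k → rotate k k′ v < rotate k k′ (suc v)
rotate-suc {k} {k′} {v} sv≢k with k ≤? v
... | yes k≤v = begin-strict
  v ∸ k            <⟨ ∸-monoˡ-< (n<1+n v) k≤v ⟩
  suc v ∸ k        ≡⟨ rotate-≥ (m≤n⇒m≤1+n k≤v) ⟨
  rotate k k′ (suc v) ∎
  where open ≤-Reasoning
... | no k≰v  = begin-strict
  v + k′           <⟨ +-monoˡ-< k′ (n<1+n v) ⟩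
  suc v + k′       ≡⟨ rotate-< (≤∧≢⇒< (≰⇒> k≰v) sv≢k) ⟨
  rotate k k′ (suc v) ∎
  where open ≤-Reasoning

rotate-wrap : ∀ {k k′ v} → 0 < k → k ≤ v → v < k + k′ → rotate k k′ v < rotate k k′ 0
rotate-wrap {k} {k′} {v} 0<k k≤v v<k+k′ = begin-strict
  rotate k k′ v  ≡⟨ rotate-≥ k≤v ⟩
  v ∸ k          <⟨ m≤n<m+o⇒n∸m<o k≤v v<k+k′ ⟩
  k′             ≡⟨ rotate-< 0<k ⟨
  rotate k k′ 0  ∎
  where open ≤-Reasoning

next-cases : ∀ {m} (j : Fin (suc m)) →
  (toℕ j < m × toℕ (next j) ≡ suc (toℕ j)) ⊎ (toℕ j ≡ m × toℕ (next j) ≡ 0)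
next-cases {m} j with toℕ j <? m
... | yes j<m = inj₁ (j<m , trans (toℕ-fromℕ< _) (m≤n⇒m%n≡m j<m))
... | no j≮m  = inj₂ (j≡m , trans (toℕ-fromℕ< _) (trans (cong (λ t → suc t % suc m) j≡m) (n%n≡0 (suc m))))
  where
  j≡m : toℕ j ≡ m
  j≡m = ≤-antisym (s≤s⁻¹ (toℕ<n j)) (≮⇒≥ j≮m)

rotate-along-cycle : ∀ {m k k′} (j : Fin (suc m)) → k ≤ m → m < k + k′ → toℕ (next j) ≢ k →
  rotate k k′ (toℕ j) < rotate k k′ (toℕ (next j))
rotate-along-cycle j k≤m m<k+k′ next≢k with next-cases j
... | inj₁ (_ , next≡suc) rewrite next≡suc = rotate-suc next≢k
... | inj₂ (j≡m , next≡0) rewrite next≡0 =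
  rotate-wrap (≤∧≢⇒< z≤n next≢k)
              (subst (_ ≤_) (sym j≡m) k≤m)
              (subst (_< _) (sym j≡m) m<k+k′)

module _ {n : ℕ} (k k′ : ℕ) (k+k′≡n : k + k′ ≡ n) where

  rotateFin : Fin n → Fin n
  rotateFin x = fromℕ< (subst (rotate k k′ (toℕ x) <_) k+k′≡n
                              (rotate<k+k′ {k} {k′} (subst (toℕ x <_) (sym k+k′≡n) (toℕ<n x))))

  toℕ-rotateFin : ∀ x → toℕ (rotateFin x) ≡ rotate k k′ (toℕ x)
  toℕ-rotateFin x = toℕ-fromℕ< _

rotateFin-inverse : ∀ {n} k k′ (k+k′≡n : k + k′ ≡ n) (k′+k≡n : k′ + k ≡ n) x →
  rotateFin k′ k k′+k≡n (rotateFin k k′ k+k′≡n x) ≡ x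
rotateFin-inverse k k′ k+k′≡n k′+k≡n x = toℕ-injective (begin
  toℕ (rotateFin k′ k k′+k≡n (rotateFin k k′ k+k′≡n x))  ≡⟨ toℕ-rotateFin k′ k k′+k≡n _ ⟩
  rotate k′ k (toℕ (rotateFin k k′ k+k′≡n x))            ≡⟨ cong (rotate k′ k) (toℕ-rotateFin k k′ k+k′≡n x) ⟩
  rotate k′ k (rotate k k′ (toℕ x))                      ≡⟨ rotate-inverse {k} {k′} (subst (toℕ x <_) (sym k+k′≡n) (toℕ<n x)) ⟩
  toℕ x                                                  ∎)
  where open ≡-Reasoning

rotation : ∀ {n} k → k ≤ n → LinOrder n
rotation {n} k k≤n = permutation (rotateFin k (n ∸ k) k+k′≡n) (rotateFin (n ∸ k) k k′+k≡n)
  (rotateFin-inverse (n ∸ k) k k′+k≡n k+k′≡n) (rotateFin-inverse k (n ∸ k) k+k′≡n k′+k≡n)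
  where
  k+k′≡n : k + (n ∸ k) ≡ n
  k+k′≡n = m+[n∸m]≡n k≤n
  k′+k≡n : (n ∸ k) + k ≡ n
  k′+k≡n = m∸n+n≡m k≤n

rank-rotation : ∀ {n} k (k≤n : k ≤ n) x → toℕ (rotation k k≤n ⟨$⟩ʳ x) ≡ rotate k (n ∸ k) (toℕ x)
rank-rotation {n} k k≤n = toℕ-rotateFin k (n ∸ k) (m+[n∸m]≡n k≤n)

m<[m/n]*n+n : ∀ m n .{{_ : NonZero n}} → m < (m / n) * n + n
m<[m/n]*n+n m n = begin-strict
  m                    ≡⟨ m≡m%n+[m/n]*n m n ⟩
  m % n + (m / n) * n  <⟨ +-monoˡ-< ((m / n) * n) (m%n<n m n) ⟩
  n + (m / n) * n      ≡⟨ +-comm n ((m / n) * n) ⟩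
  (m / n) * n + n      ∎
  where open ≤-Reasoning

module _ {n h m : ℕ} (D : ℕ) .{{_ : NonZero D}} (l≤n : suc m ≤ n) (h≤lD : h ≤ suc m * D) where

  block : Fin h → ℕ
  block i = toℕ i / D

  block≤m : ∀ i → block i ≤ m
  block≤m i = s≤s⁻¹ (m<n*o⇒m/o<n (<-≤-trans (toℕ<n i) h≤lD))

  block≤n : ∀ i → block i ≤ n
  block≤n i = ≤-trans (block≤m i) (<⇒≤ l≤n)

  blocked-profile : Profile n h
  blocked-profile i = rotation (block i) (block≤n i)

  cycle : Fin (suc m) → Fin n
  cycle j = inject≤ j l≤n

  dissent⇒block : ∀ j i → ¬ (cycle j ≻[ blocked-profile i ] cycle (next j)) → block i ≡ toℕ (next j)
  dissent⇒block j i dissent with block i ≟ toℕ (next j)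
  ... | yes b≡next = b≡next
  ... | no b≢next  = contradiction assent dissent
    where
    rank : ∀ j′ → toℕ (blocked-profile i ⟨$⟩ʳ cycle j′) ≡ rotate (block i) (n ∸ block i) (toℕ j′)
    rank j′ = trans (rank-rotation (block i) (block≤n i) (cycle j′))
                    (cong (rotate (block i) (n ∸ block i)) (toℕ-inject≤ j′ l≤n))
    m<n : m < block i + (n ∸ block i)
    m<n = subst (m <_) (sym (m+[n∸m]≡n (block≤n i))) l≤n
    assent : cycle j ≻[ blocked-profile i ] cycle (next j)
    assent = subst₂ _<_ (sym (rank j)) (sym (rank (next j)))
               (rotate-along-cycle j (block≤m i) m<n (b≢next ∘ sym))

  support-blocked : ∀ j → h ∸ D ≤ support blocked-profile (cycle j) (cycle (next j))
  support-blocked j = subst (h ∸ D ≤_) (sym (support≡count blocked-profile (cycle j) (cycle (next j))))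
                            (m≤n+o⇒m∸n≤o h D h≤D+assents)
    where
    open ≤-Reasoning
    assent? : ∀ i → Dec (cycle j ≻[ blocked-profile i ] cycle (next j))
    assent? i = toℕ (blocked-profile i ⟨$⟩ʳ cycle j) <? toℕ (blocked-profile i ⟨$⟩ʳ cycle (next j))
    w : ℕ
    w = toℕ (next j)
    in-block? : ∀ i → Dec (block i ≡ w)
    in-block? i = block i ≟ w
    block-interval : ∀ i → block i ≡ w → w * D ≤ toℕ i × toℕ i < w * D + D
    block-interval i b≡w = subst (λ q → q * D ≤ toℕ i × toℕ i < q * D + D) b≡w
                                 (m/n*n≤m (toℕ i) D , m<[m/n]*n+n (toℕ i) D)
    h≤D+assents : h ≤ D + count assent?
    h≤D+assents = begin
      h                              ≤⟨ count-cover assent? in-block? (dissent⇒block j) ⟩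
      count assent? + count in-block? ≤⟨ +-monoʳ-≤ (count assent?) (count-interval in-block? (w * D) D block-interval) ⟩
      count assent? + D              ≡⟨ +-comm (count assent?) D ⟩
      D + count assent?              ∎

  blocked-profile-cyclic : ∃ λ (p : Profile n h) → IsCyclic (suc m) (Arc (h ∸ D) p)
  blocked-profile-cyclic = blocked-profile , cycle , (λ {x} {y} → inject≤-injective l≤n l≤n x y) , support-blocked

h≤l*[h∸μ] : ∀ {h μ m} → suc m * μ ≤ m * h → h ≤ suc m * (h ∸ μ)
h≤l*[h∸μ] {h} {μ} {m} bound = begin
  h                        ≡⟨ m+n∸n≡m h (m * h) ⟨
  h + m * h ∸ m * h        ≤⟨ ∸-monoʳ-≤ (h + m * h) bound ⟩
  suc m * h ∸ suc m * μ    ≡⟨ *-distribˡ-∸ (suc m) h μ ⟨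
  suc m * (h ∸ μ)          ∎
  where open ≤-Reasoning

proposition21 : (n h μ l : ℕ) → 2 ≤ n → 2 ≤ h → h < 2 * μ → μ ≤ h → 2 ≤ l → l ≤ n →
    (∃ λ (p : Profile n h) → IsCyclic l (Arc μ p)) ⇔ (l * μ ≤ (l ∸ 1) * h)
proposition21 n h μ (suc m) _ 2≤h _ μ≤h (s≤s _) l≤n = mk⇔ (λ (p , cyclic) → cyclic⇒l*μ≤[l∸1]*h p cyclic) sufficient
  where
  sufficient : suc m * μ ≤ m * h → ∃ λ (p : Profile n h) → IsCyclic (suc m) (Arc μ p)
  sufficient bound = subst (λ t → ∃ λ (p : Profile n h) → IsCyclic (suc m) (Arc t p)) (m∸[m∸n]≡n μ≤h)
                           (blocked-profile-cyclic (h ∸ μ) {{h∸μ≢0}} l≤n h≤lD)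
    where
    h≤lD : h ≤ suc m * (h ∸ μ)
    h≤lD = h≤l*[h∸μ] {h} {μ} {m} bound
    h∸μ≢0 : NonZero (h ∸ μ)
    h∸μ≢0 = m*n≢0⇒n≢0 (suc m) {{>-nonZero (≤-trans (≤-trans (s≤s z≤n) 2≤h) h≤lD)}}
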